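{- Let $R(m,n)$ denote the number of Rogers--Ramanujan partitions of $n$ with rank $m$. Then, as formal power series (equivalently for $|q|<1$ and $|zq|<1$), \[ \sum_{n=0}^{\infty}\sum_{m=-\infty}^{\infty}R(m,n)\,z^mq^n=\sum_{n=0}^{\infty}\frac{z^{n-1}q^{n^2}}{(zq;q)_n}. \]
   Context: A Rogers--Ramanujan partition of $n$ is a partition of $n$ in which any two parts differ by at least $2$. The (Dyson) rank of a partition is its largest part minus its number of parts; for the empty partition (the only Rogers--Ramanujan partition of $0$), the identity corresponds to the convention that its contribution is $z^{ -1}$, i.e. it is assigned rank $-1$. Notation: $(a;q)_0=1$ and $(a;q)_n=(1-a)(1-aq)\cdots(1-aq^{n-1})$ for $n\ge1$. -}

module Defs where

open import Data.Bool using (Bool; true; false; _∧_)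
open import Data.Nat using (ℕ; zero; suc; _∸_; _≤ᵇ_; _≡ᵇ_)
import Data.Nat as ℕ
open import Data.Integer using (ℤ; +_; -[1+_]; _+_; _-_; _*_; 0ℤ; 1ℤ; -1ℤ)
open import Data.Nat.ListAction using (sum)
open import Data.List using (List; []; _∷_; map; _++_; length; downFrom; filterᵇ; [_])

sublists : List ℕ → List (List ℕ)
sublists []       = [ [] ]
sublists (x ∷ xs) = map (x ∷_) (sublists xs) ++ sublists xs

partsUpTo : ℕ → List ℕ
partsUpTo n = map suc (downFrom n)

gapsAtLeast2 : List ℕ → Bool
gapsAtLeast2 []           = true
gapsAtLeast2 (x ∷ [])     = true
gapsAtLeast2 (x ∷ y ∷ ys) = (suc (suc y) ≤ᵇ x) ∧ gapsAtLeast2 (y ∷ ys)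

-- Every partition of n into distinct parts is a subset of {1,...,n}; listing
-- the parts in decreasing order, these are exactly the sublists of
-- [n, ..., 1] (each occurring exactly once).
rrPartitions : ℕ → List (List ℕ)
rrPartitions n =
  filterᵇ (λ p → (sum p ≡ᵇ n) ∧ gapsAtLeast2 p) (sublists (partsUpTo n))

-- Dyson rank: largest part minus number of parts (parts listed in
-- decreasing order, so the head is the largest part); the empty partition
-- gets rank -1 by the stated convention.
rank : List ℕ → ℤ
rank []       = -1ℤ
rank (x ∷ xs) = + x - + length (x ∷ xs)

_==ℤ_ : ℤ → ℤ → Bool
(+ a)    ==ℤ (+ b)    = a ≡ᵇ b
-[1+ a ] ==ℤ -[1+ b ] = a ≡ᵇ b
_        ==ℤ _        = false

R : ℤ → ℕ → ℕ
R m n = length (filterᵇ (λ p → rank p ==ℤ m) (rrPartitions n))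

-- Formal power series in z and q over ℤ: f a b = coefficient of z^a q^b

FPS2 : Set
FPS2 = ℕ → ℕ → ℤ

sumTo : ℕ → (ℕ → ℤ) → ℤ
sumTo zero    f = f zero
sumTo (suc k) f = sumTo k f + f (suc k)

oneS : FPS2
oneS zero zero = 1ℤ
oneS _    _    = 0ℤ

_⊛_ : FPS2 → FPS2 → FPS2
(f ⊛ g) a b = sumTo a (λ i → sumTo b (λ j → f i j * g (a ∸ i) (b ∸ j)))

-- 1/(1 - z q^k) = Σ_{j≥0} z^j q^{k j}
geomZQ : ℕ → FPS2
geomZQ k a b with b ≡ᵇ k ℕ.* a
... | true  = 1ℤ
... | false = 0ℤ

-- 1/(zq;q)_n = Π_{k=1}^{n} 1/(1 - z q^k)
invPoch : ℕ → FPS2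
invPoch zero    = oneS
invPoch (suc n) = invPoch n ⊛ geomZQ (suc n)

-- coefficient of z^m q^N in  z^{n-1} q^{n^2} / (zq;q)_n   (m ∈ ℤ)
termCoeff : ℕ → ℤ → ℕ → ℤ
termCoeff n m N with m + 1ℤ - + n | n ℕ.* n ≤ᵇ N
... | + a     | true  = invPoch n a (N ∸ n ℕ.* n)
... | + a     | false = 0ℤ
... | -[1+ _ ] | _    = 0ℤ

-- coefficient of z^m q^N in  Σ_{n≥0} z^{n-1} q^{n^2} / (zq;q)_n.
-- The n-th term is divisible by q^{n^2}, so only n ≤ N (indeed n^2 ≤ N)
-- contribute to the q^N coefficient: the formal sum is the finite sum below.
rhsCoeff : ℤ → ℕ → ℤ
rhsCoeff m N = sumTo N (λ n → termCoeff n m N)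

module Submission where

open import Defs
open import Data.Nat using (ℕ)
open import Data.Integer using (ℤ; +_)
open import Relation.Binary.PropositionalEquality using (_≡_)

open import Data.Bool using (Bool; true; false; _∧_; if_then_else_; T)
open import Data.Bool.Properties using (∧-assoc; ∧-comm; ∧-identityʳ; T-≡; T-∧)
open import Data.Empty using (⊥-elim)
open import Data.Integer as ℤ using (0ℤ; 1ℤ; -1ℤ; -[1+_]; +≤+)
import Data.Integer.Properties as ℤP
import Data.Integer.Tactic.RingSolver as ℤ-Solver
open import Algebra.Properties.CommutativeSemigroup ℤP.+-commutativeSemigroup using (interchange)
open import Data.List using (List; []; _∷_; [_]; map; _++_; length; filterᵇ; downFrom)
open import Data.List.Properties using (length-map; length-downFrom)
open import Data.List.Relation.Unary.All as All using (All; []; _∷_)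
open import Data.List.Relation.Unary.All.Properties using (++⁺; map⁺)
open import Data.Nat using (zero; suc; 2+; _+_; _*_; _∸_; _≤_; _<_; _≡ᵇ_; _≤ᵇ_; z≤n; s≤s)
open import Data.Nat.ListAction using (sum)
open import Data.Nat.Properties
open import Data.Nat.Tactic.RingSolver using (solve-∀)
open import Data.Product using (_×_; _,_; proj₁; proj₂)
open import Data.Sum using (inj₁; inj₂)
open import Function using (_∘_; Equivalence; mk⇔)
open import Relation.Nullary using (¬_; does)
open import Relation.Nullary.Decidable using (does-⇔; dec-true; dec-false)
open import Relation.Binary.PropositionalEquality
  using (_≗_; _≢_; refl; sym; cong; cong₂; subst; _→-setoid_; module ≡-Reasoning)
  renaming (trans to infixr 5 _∙_)
import Relation.Binary.Reasoning.Setoid as SetoidReasoning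

-- Removing the largest part L from a Rogers–Ramanujan partition with k + 1 parts leaves one with
-- k parts, all at most L − 2. Subtracting the staircase (2k − 1, …, 3, 1) from those turns them
-- into the partitions into at most k parts of size at most a = L − 2k − 1, counted by the Gaussian
-- polynomial [k + a, k]_q. The rank is L − k − 1, so rank m means a = m − k, and these partitions
-- contribute q^((k+1)² + a) [k + a, k]_q. On the other side, the coefficient of z^a in
-- 1/(zq;q)_(k+1) counts partitions into exactly a parts of size at most k + 1; subtracting 1 from
-- every part gives q^a [k + a, a]_q. The two agree by the conjugation symmetry of Gaussian
-- polynomials, i.e. because they satisfy the q-Pascal recurrence in both of its forms.

Series : Set
Series = ℕ → ℤ

infixl 6 _⊕_
infixr 7 q^_·_

𝟎 : Series
𝟎 _ = 0ℤ

δ : Series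
δ zero    = 1ℤ
δ (suc _) = 0ℤ

_⊕_ : Series → Series → Series
(f ⊕ g) s = f s ℤ.+ g s

q^_·_ : ℕ → Series → Series
(q^ zero  · f) s       = f s
(q^ suc d · f) zero    = 0ℤ
(q^ suc d · f) (suc s) = (q^ d · f) s

module ≗-Reasoning = SetoidReasoning (ℕ →-setoid ℤ)

⊕-cong : ∀ {f f′ g g′} → f ≗ f′ → g ≗ g′ → f ⊕ g ≗ f′ ⊕ g′
⊕-cong f≗f′ g≗g′ s = cong₂ ℤ._+_ (f≗f′ s) (g≗g′ s)

⊕-congˡ : ∀ f {g g′} → g ≗ g′ → f ⊕ g ≗ f ⊕ g′
⊕-congˡ f = ⊕-cong {f} (λ _ → refl)

⊕-identityˡ : ∀ f → 𝟎 ⊕ f ≗ f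
⊕-identityˡ f s = ℤP.+-identityˡ (f s)

⊕-identityʳ : ∀ f → f ⊕ 𝟎 ≗ f
⊕-identityʳ f s = ℤP.+-identityʳ (f s)

⊕-comm : ∀ f g → f ⊕ g ≗ g ⊕ f
⊕-comm f g s = ℤP.+-comm (f s) (g s)

⊕-assoc : ∀ f g h → (f ⊕ g) ⊕ h ≗ f ⊕ (g ⊕ h)
⊕-assoc f g h s = ℤP.+-assoc (f s) (g s) (h s)

⊕-interchange : ∀ f g h k → (f ⊕ g) ⊕ (h ⊕ k) ≗ (f ⊕ h) ⊕ (g ⊕ k)
⊕-interchange f g h k s = interchange (f s) (g s) (h s) (k s)

q^-cong : ∀ d {f g} → f ≗ g → q^ d · f ≗ q^ d · g
q^-cong zero    f≗g s       = f≗g s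
q^-cong (suc d) f≗g zero    = refl
q^-cong (suc d) f≗g (suc s) = q^-cong d f≗g s

q^-𝟎 : ∀ d → q^ d · 𝟎 ≗ 𝟎
q^-𝟎 zero    s       = refl
q^-𝟎 (suc d) zero    = refl
q^-𝟎 (suc d) (suc s) = q^-𝟎 d s

q^-⊕ : ∀ d f g → q^ d · (f ⊕ g) ≗ q^ d · f ⊕ q^ d · g
q^-⊕ zero    f g s       = refl
q^-⊕ (suc d) f g zero    = refl
q^-⊕ (suc d) f g (suc s) = q^-⊕ d f g s

q^-+ : ∀ d e f → q^ (d + e) · f ≗ q^ d · q^ e · f
q^-+ zero    e f s       = refl
q^-+ (suc d) e f zero    = refl
q^-+ (suc d) e f (suc s) = q^-+ d e f s

q^-merge : ∀ d e {n} f → d + e ≡ n → q^ d · q^ e · f ≗ q^ n · f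
q^-merge d e f refl s = sym (q^-+ d e f s)

q^-regroup : ∀ d e d′ e′ f → d + e ≡ d′ + e′ → q^ d · q^ e · f ≗ q^ d′ · q^ e′ · f
q^-regroup d e d′ e′ f eq s = q^-merge d e f eq s ∙ sym (q^-merge d′ e′ f refl s)

q^-< : ∀ d f {s} → s < d → (q^ d · f) s ≡ 0ℤ
q^-< (suc d) f {zero}  _         = refl
q^-< (suc d) f {suc s} (s≤s s<d) = q^-< d f s<d

q^-≤ᵇ : ∀ d f s → (q^ d · f) s ≡ (if d ≤ᵇ s then f (s ∸ d) else 0ℤ)
q^-≤ᵇ zero          f s       = refl
q^-≤ᵇ (suc d)       f zero    = refl
q^-≤ᵇ (suc zero)    f (suc s) = refl
q^-≤ᵇ (suc (suc d)) f (suc s) = q^-≤ᵇ (suc d) f s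

sumTo-cong : ∀ k {f g : ℕ → ℤ} → (∀ i → i ≤ k → f i ≡ g i) → sumTo k f ≡ sumTo k g
sumTo-cong zero    f≡g = f≡g 0 z≤n
sumTo-cong (suc k) f≡g =
  cong₂ ℤ._+_ (sumTo-cong k (λ i i≤k → f≡g i (m≤n⇒m≤1+n i≤k))) (f≡g (suc k) ≤-refl)

sumTo-zero : ∀ k {f : ℕ → ℤ} → (∀ i → i ≤ k → f i ≡ 0ℤ) → sumTo k f ≡ 0ℤ
sumTo-zero k f≡0 = sumTo-cong k f≡0 ∙ sumTo-𝟎 k
  where
  sumTo-𝟎 : ∀ k → sumTo k 𝟎 ≡ 0ℤ
  sumTo-𝟎 zero    = refl
  sumTo-𝟎 (suc k) = cong (ℤ._+ 0ℤ) (sumTo-𝟎 k)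

sumTo-+ : ∀ k (f g : ℕ → ℤ) → sumTo k (λ i → f i ℤ.+ g i) ≡ sumTo k f ℤ.+ sumTo k g
sumTo-+ zero    f g = refl
sumTo-+ (suc k) f g =
  cong (ℤ._+ (f (suc k) ℤ.+ g (suc k))) (sumTo-+ k f g)
  ∙ interchange (sumTo k f) (sumTo k g) (f (suc k)) (g (suc k))

q^-sumTo : ∀ d a (F : ℕ → Series) →
  q^ d · (λ s → sumTo a (λ i → F i s)) ≗ (λ s → sumTo a (λ i → (q^ d · F i) s))
q^-sumTo d zero    F s = refl
q^-sumTo d (suc a) F s =
  q^-⊕ d (λ s → sumTo a (λ i → F i s)) (F (suc a)) s
  ∙ cong (ℤ._+ (q^ d · F (suc a)) s) (q^-sumTo d a F s)

indicator : Bool → ℤ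
indicator true  = 1ℤ
indicator false = 0ℤ

sumTo-indicator : ∀ N ℓ b → ℓ ≤ N → sumTo N (λ n → indicator (b ∧ (ℓ ≡ᵇ n))) ≡ indicator b
sumTo-indicator N       ℓ    false _   = sumTo-zero N (λ _ _ → refl)
sumTo-indicator zero    zero true  _   = refl
sumTo-indicator (suc N) ℓ    true  ℓ≤N with m≤n⇒m<n∨m≡n ℓ≤N
... | inj₁ (s≤s ℓ≤N′) =
  cong₂ ℤ._+_ (sumTo-indicator N ℓ true ℓ≤N′)
              (cong indicator (dec-false (ℓ ≟ suc N) (λ ℓ≡ → <-irrefl ℓ≡ (s≤s ℓ≤N′))))
... | inj₂ refl =
  cong₂ ℤ._+_ (sumTo-zero N (λ n n≤N → cong indicator (dec-false (suc N ≟ n) (too-big n≤N))))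
              (cong indicator (dec-true (suc N ≟ suc N) refl))
  where
  too-big : ∀ {n} → n ≤ N → suc N ≢ n
  too-big n≤N ≡n = <-irrefl (sym ≡n) (s≤s n≤N)

sumTo-delta : ∀ (f : Series) d b →
  sumTo b (λ j → f j ℤ.* indicator (b ∸ j ≡ᵇ d)) ≡ (q^ d · f) b
sumTo-delta f zero    zero    = ℤP.*-identityʳ (f 0)
sumTo-delta f (suc d) zero    = ℤP.*-zeroʳ (f 0)
sumTo-delta f d       (suc b) =
  cong₂ ℤ._+_ (sumTo-cong b (λ j j≤b → cong (term j) (+-∸-assoc 1 j≤b)))
              (cong (term (suc b)) (n∸n≡0 b))
  ∙ last d
  where
  term : ℕ → ℕ → ℤ
  term j e = f j ℤ.* indicator (e ≡ᵇ d)
  last : ∀ d → sumTo b (λ j → f j ℤ.* indicator (suc (b ∸ j) ≡ᵇ d))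
                 ℤ.+ f (suc b) ℤ.* indicator (0 ≡ᵇ d)
               ≡ (q^ d · f) (suc b)
  last zero    = cong₂ ℤ._+_ (sumTo-zero b (λ j _ → ℤP.*-zeroʳ (f j))) (ℤP.*-identityʳ (f (suc b)))
                 ∙ ℤP.+-identityˡ (f (suc b))
  last (suc d) = cong₂ ℤ._+_ (sumTo-delta f d b) (ℤP.*-zeroʳ (f (suc b)))
                 ∙ ℤP.+-identityʳ ((q^ d · f) b)

-- Gaussian polynomials

-- qBinomial k c = [k + c, k]_q, counting partitions into at most k parts, each at most c.
qBinomial : ℕ → ℕ → Series
qBinomial zero    c       = δ
qBinomial (suc k) zero    = δ
qBinomial (suc k) (suc c) = qBinomial (suc k) c ⊕ q^ suc c · qBinomial k (suc c)

qBinomial-zeroʳ : ∀ k → qBinomial k 0 ≗ δ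
qBinomial-zeroʳ zero    s = refl
qBinomial-zeroʳ (suc k) s = refl

-- The defining recurrence with the roles of k and c exchanged: conjugation transposes the box.
qBinomial-pascal′ : ∀ k c →
  qBinomial (suc k) (suc c) ≗ qBinomial k (suc c) ⊕ q^ suc k · qBinomial (suc k) c
qBinomial-pascal′ zero    zero    s = refl
qBinomial-pascal′ zero    (suc c) = begin
  qBinomial 1 (suc c) ⊕ q^ 2+ c · δ
    ≈⟨ ⊕-cong (qBinomial-pascal′ zero c) (q^-+ 1 (suc c) δ) ⟩
  (δ ⊕ q^ 1 · qBinomial 1 c) ⊕ q^ 1 · q^ suc c · δ
    ≈⟨ ⊕-assoc δ (q^ 1 · qBinomial 1 c) (q^ 1 · q^ suc c · δ) ⟩
  δ ⊕ (q^ 1 · qBinomial 1 c ⊕ q^ 1 · q^ suc c · δ)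
    ≈⟨ ⊕-congˡ δ (q^-⊕ 1 (qBinomial 1 c) (q^ suc c · δ)) ⟨
  δ ⊕ q^ 1 · qBinomial 1 (suc c) ∎
  where open ≗-Reasoning
qBinomial-pascal′ (suc k) zero    = begin
  δ ⊕ q^ 1 · qBinomial (suc k) 1
    ≈⟨ ⊕-congˡ δ (q^-cong 1 (qBinomial-pascal′ k zero)) ⟩
  δ ⊕ q^ 1 · (qBinomial k 1 ⊕ q^ suc k · δ)
    ≈⟨ ⊕-congˡ δ (q^-⊕ 1 (qBinomial k 1) (q^ suc k · δ)) ⟩
  δ ⊕ (q^ 1 · qBinomial k 1 ⊕ q^ 1 · q^ suc k · δ)
    ≈⟨ ⊕-assoc δ (q^ 1 · qBinomial k 1) (q^ 1 · q^ suc k · δ) ⟨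
  qBinomial (suc k) 1 ⊕ q^ 1 · q^ suc k · δ
    ≈⟨ ⊕-congˡ (qBinomial (suc k) 1) (q^-+ 1 (suc k) δ) ⟨
  qBinomial (suc k) 1 ⊕ q^ 2+ k · δ ∎
  where open ≗-Reasoning
qBinomial-pascal′ (suc k) (suc c) = begin
  qBinomial (2+ k) (suc c) ⊕ q^ 2+ c · qBinomial (suc k) (2+ c)
    ≈⟨ ⊕-cong (qBinomial-pascal′ (suc k) c) (q^-cong (2+ c) (qBinomial-pascal′ k (suc c))) ⟩
  (C ⊕ q^ 2+ k · D) ⊕ q^ 2+ c · (E ⊕ q^ suc k · C)
    ≈⟨ ⊕-congˡ (C ⊕ q^ 2+ k · D) (q^-⊕ (2+ c) E (q^ suc k · C)) ⟩
  (C ⊕ q^ 2+ k · D) ⊕ (q^ 2+ c · E ⊕ q^ 2+ c · q^ suc k · C)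
    ≈⟨ ⊕-interchange C (q^ 2+ k · D) (q^ 2+ c · E) (q^ 2+ c · q^ suc k · C) ⟩
  (C ⊕ q^ 2+ c · E) ⊕ (q^ 2+ k · D ⊕ q^ 2+ c · q^ suc k · C)
    ≈⟨ ⊕-congˡ (C ⊕ q^ 2+ c · E) (⊕-congˡ (q^ 2+ k · D)
         (q^-regroup (2+ c) (suc k) (2+ k) (suc c) C (exponents c k))) ⟩
  (C ⊕ q^ 2+ c · E) ⊕ (q^ 2+ k · D ⊕ q^ 2+ k · q^ suc c · C)
    ≈⟨ ⊕-congˡ (C ⊕ q^ 2+ c · E) (q^-⊕ (2+ k) D (q^ suc c · C)) ⟨
  qBinomial (suc k) (2+ c) ⊕ q^ 2+ k · qBinomial (2+ k) (suc c) ∎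
  where
  open ≗-Reasoning
  C = qBinomial (suc k) (suc c)
  D = qBinomial (2+ k) c
  E = qBinomial k (2+ c)
  exponents : ∀ c k → 2+ c + suc k ≡ 2+ k + suc c
  exponents = solve-∀

-- The coefficients of 1/(zq;q)_n

geomZQ-indicator : ∀ k a y → geomZQ k a y ≡ indicator (y ≡ᵇ k * a)
geomZQ-indicator k a y with y ≡ᵇ k * a
... | true  = refl
... | false = refl

⊛-geomZQ : ∀ (F : FPS2) k a b → (F ⊛ geomZQ k) a b ≡ sumTo a (λ i → (q^ k * (a ∸ i) · F i) b)
⊛-geomZQ F k a b = sumTo-cong a λ i _ →
  sumTo-cong b (λ j _ → cong (F i j ℤ.*_) (geomZQ-indicator k (a ∸ i) (b ∸ j)))
  ∙ sumTo-delta (F i) (k * (a ∸ i)) b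

⊛-geomZQ-zero : ∀ F k → (F ⊛ geomZQ k) 0 ≗ F 0
⊛-geomZQ-zero F k b = ⊛-geomZQ F k 0 b ∙ cong (λ d → (q^ d · F 0) b) (*-zeroʳ k)

-- (1 − z q^k) (F ⊛ geomZQ k) = F
⊛-geomZQ-suc : ∀ F k a → (F ⊛ geomZQ k) (suc a) ≗ F (suc a) ⊕ q^ k · (F ⊛ geomZQ k) a
⊛-geomZQ-suc F k a b = begin
  (F ⊛ geomZQ k) (suc a) b
    ≡⟨ ⊛-geomZQ F k (suc a) b ⟩
  sumTo a (λ i → (q^ k * (suc a ∸ i) · F i) b) ℤ.+ (q^ k * (a ∸ a) · F (suc a)) b
    ≡⟨ cong₂ ℤ._+_ (sumTo-cong a factor-q^k) (cong (λ d → (q^ k * d · F (suc a)) b) (n∸n≡0 a)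
                                              ∙ cong (λ d → (q^ d · F (suc a)) b) (*-zeroʳ k)) ⟩
  sumTo a (λ i → (q^ k · q^ k * (a ∸ i) · F i) b) ℤ.+ F (suc a) b
    ≡⟨ cong (ℤ._+ F (suc a) b) (q^-sumTo k a (λ i → q^ k * (a ∸ i) · F i) b) ⟨
  (q^ k · (λ s → sumTo a (λ i → (q^ k * (a ∸ i) · F i) s))) b ℤ.+ F (suc a) b
    ≡⟨ cong (ℤ._+ F (suc a) b) (q^-cong k (⊛-geomZQ F k a) b) ⟨
  (q^ k · (F ⊛ geomZQ k) a) b ℤ.+ F (suc a) b
    ≡⟨ ℤP.+-comm ((q^ k · (F ⊛ geomZQ k) a) b) (F (suc a) b) ⟩
  F (suc a) b ℤ.+ (q^ k · (F ⊛ geomZQ k) a) b ∎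
  where
  open ≡-Reasoning
  factor-q^k : ∀ i → i ≤ a → (q^ k * (suc a ∸ i) · F i) b ≡ (q^ k · q^ k * (a ∸ i) · F i) b
  factor-q^k i i≤a =
    cong (λ d → (q^ d · F i) b) (cong (k *_) (+-∸-assoc 1 i≤a) ∙ *-suc k (a ∸ i))
    ∙ q^-+ k (k * (a ∸ i)) (F i) b

oneS-zero : oneS 0 ≗ δ
oneS-zero zero    = refl
oneS-zero (suc b) = refl

invPoch-suc : ∀ n a → invPoch (suc n) a ≗ q^ a · qBinomial n a
invPoch-suc zero    zero    b = ⊛-geomZQ-zero oneS 1 b ∙ oneS-zero b
invPoch-suc zero    (suc a) = begin
  invPoch 1 (suc a)        ≈⟨ ⊛-geomZQ-suc oneS 1 a ⟩
  𝟎 ⊕ q^ 1 · invPoch 1 a   ≈⟨ ⊕-identityˡ (q^ 1 · invPoch 1 a) ⟩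
  q^ 1 · invPoch 1 a       ≈⟨ q^-cong 1 (invPoch-suc zero a) ⟩
  q^ 1 · q^ a · δ          ≈⟨ q^-+ 1 a δ ⟨
  q^ suc a · δ             ∎
  where open ≗-Reasoning
invPoch-suc (suc n) zero    = begin
  invPoch (2+ n) 0         ≈⟨ ⊛-geomZQ-zero (invPoch (suc n)) (2+ n) ⟩
  invPoch (suc n) 0        ≈⟨ invPoch-suc n zero ⟩
  qBinomial n 0            ≈⟨ qBinomial-zeroʳ n ⟩
  δ                        ∎
  where open ≗-Reasoning
invPoch-suc (suc n) (suc a) = begin
  invPoch (2+ n) (suc a)
    ≈⟨ ⊛-geomZQ-suc (invPoch (suc n)) (2+ n) a ⟩
  invPoch (suc n) (suc a) ⊕ q^ 2+ n · invPoch (2+ n) a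
    ≈⟨ ⊕-cong (invPoch-suc n (suc a)) (q^-cong (2+ n) (invPoch-suc (suc n) a)) ⟩
  q^ suc a · qBinomial n (suc a) ⊕ q^ 2+ n · q^ a · qBinomial (suc n) a
    ≈⟨ ⊕-congˡ (q^ suc a · qBinomial n (suc a))
         (q^-regroup (2+ n) a (suc a) (suc n) (qBinomial (suc n) a) (exponents n a)) ⟩
  q^ suc a · qBinomial n (suc a) ⊕ q^ suc a · q^ suc n · qBinomial (suc n) a
    ≈⟨ q^-⊕ (suc a) (qBinomial n (suc a)) (q^ suc n · qBinomial (suc n) a) ⟨
  q^ suc a · (qBinomial n (suc a) ⊕ q^ suc n · qBinomial (suc n) a)
    ≈⟨ q^-cong (suc a) (qBinomial-pascal′ n a) ⟨
  q^ suc a · qBinomial (suc n) (suc a) ∎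
  where
  open ≗-Reasoning
  exponents : ∀ n a → 2+ n + a ≡ suc a + suc n
  exponents = solve-∀

count : {A : Set} → (A → Bool) → List A → ℤ
count P []       = 0ℤ
count P (x ∷ xs) = indicator (P x) ℤ.+ count P xs

¬T-∧ʳ : ∀ a {b} → ¬ T b → ¬ T (a ∧ b)
¬T-∧ʳ a ¬b = ¬b ∘ proj₂ ∘ Equivalence.to T-∧

module _ {A : Set} where

  count-++ : ∀ (P : A → Bool) xs ys → count P (xs ++ ys) ≡ count P xs ℤ.+ count P ys
  count-++ P []       ys = sym (ℤP.+-identityˡ (count P ys))
  count-++ P (x ∷ xs) ys = cong (λ c → indicator (P x) ℤ.+ c) (count-++ P xs ys)
                           ∙ sym (ℤP.+-assoc (indicator (P x)) (count P xs) (count P ys))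

  count-map : ∀ {B : Set} (P : B → Bool) (f : A → B) xs → count P (map f xs) ≡ count (P ∘ f) xs
  count-map P f []       = refl
  count-map P f (x ∷ xs) = cong (λ c → indicator (P (f x)) ℤ.+ c) (count-map P f xs)

  count-cong : ∀ {P Q : A → Bool} {xs} → All (λ x → P x ≡ Q x) xs → count P xs ≡ count Q xs
  count-cong []             = refl
  count-cong (Px≡Qx ∷ rest) = cong₂ ℤ._+_ (cong indicator Px≡Qx) (count-cong rest)

  count-none : ∀ {P : A → Bool} {xs} → All (λ x → ¬ T (P x)) xs → count P xs ≡ 0ℤ
  count-none {P} {[]}     []           = refl
  count-none {P} {x ∷ xs} (¬Px ∷ rest) with P x
  ... | true  = ⊥-elim (¬Px _)
  ... | false = ℤP.+-identityˡ (count P xs) ∙ count-none rest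

  count-filterᵇ : ∀ (P Q : A → Bool) xs →
    + length (filterᵇ Q (filterᵇ P xs)) ≡ count (λ x → P x ∧ Q x) xs
  count-filterᵇ P Q []       = refl
  count-filterᵇ P Q (x ∷ xs) with P x
  ... | false = count-filterᵇ P Q xs ∙ sym (ℤP.+-identityˡ _)
  ... | true  with Q x
  ...   | true  = cong (λ c → 1ℤ ℤ.+ c) (count-filterᵇ P Q xs)
  ...   | false = count-filterᵇ P Q xs ∙ sym (ℤP.+-identityˡ _)

  count-by-fibres : ∀ (f : A → ℕ) N P xs → All (λ x → f x ≤ N) xs →
    count P xs ≡ sumTo N (λ n → count (λ x → P x ∧ (f x ≡ᵇ n)) xs)
  count-by-fibres f N P []       []            = sym (sumTo-zero N (λ _ _ → refl))
  count-by-fibres f N P (x ∷ xs) (fx≤N ∷ rest) =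
    cong₂ ℤ._+_ (sym (sumTo-indicator N (f x) (P x) fx≤N)) (count-by-fibres f N P xs rest)
    ∙ sym (sumTo-+ N (λ n → indicator (P x ∧ (f x ≡ᵇ n)))
                     (λ n → count (λ x → P x ∧ (f x ≡ᵇ n)) xs))

genSeries : (List ℕ → Bool) → List (List ℕ) → Series
genSeries X ps s = count (λ p → (sum p ≡ᵇ s) ∧ X p) ps

genSeries-cong : ∀ {X Y ps} → All (λ p → X p ≡ Y p) ps → genSeries X ps ≗ genSeries Y ps
genSeries-cong X≡Y s = count-cong (All.map (λ {p} → cong ((sum p ≡ᵇ s) ∧_)) X≡Y)

genSeries-none : ∀ X {ps} → All (λ p → ¬ T (X p)) ps → genSeries X ps ≗ 𝟎
genSeries-none X ¬X s = count-none (All.map (¬T-∧ʳ _) ¬X)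

genSeries-map-cons : ∀ X x ps → genSeries X (map (x ∷_) ps) ≗ q^ x · genSeries (X ∘ (x ∷_)) ps
genSeries-map-cons X x ps s = count-map _ (x ∷_) ps ∙ shifted x s
  where
  shifted : ∀ d s →
    count (λ p → (d + sum p ≡ᵇ s) ∧ X (x ∷ p)) ps ≡ (q^ d · genSeries (X ∘ (x ∷_)) ps) s
  shifted zero    s       = refl
  shifted (suc d) zero    = count-none (All.universal (λ _ ()) ps)
  shifted (suc d) (suc s) = shifted d s

genSeries-sublists : ∀ X x xs →
  genSeries X (sublists (x ∷ xs))
    ≗ q^ x · genSeries (X ∘ (x ∷_)) (sublists xs) ⊕ genSeries X (sublists xs)
genSeries-sublists X x xs s =
  count-++ _ (map (x ∷_) (sublists xs)) (sublists xs)
  ∙ cong (ℤ._+ genSeries X (sublists xs) s) (genSeries-map-cons X x (sublists xs) s)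

genSeries-by-length : ∀ N X ps → All (λ p → length p ≤ N) ps →
  ∀ s → genSeries X ps s ≡ sumTo N (λ n → genSeries (λ p → (length p ≡ᵇ n) ∧ X p) ps s)
genSeries-by-length N X ps bound s =
  count-by-fibres length N _ ps bound
  ∙ sumTo-cong N (λ n _ → count-cong
      (All.universal (λ p → reorder (sum p ≡ᵇ s) (X p) (length p ≡ᵇ n)) ps))
  where
  reorder : ∀ a x ℓ → (a ∧ x) ∧ ℓ ≡ a ∧ (ℓ ∧ x)
  reorder true  x ℓ = ∧-comm x ℓ
  reorder false x ℓ = refl

genSeries-length-zero : ∀ X xs →
  genSeries (λ p → (length p ≡ᵇ 0) ∧ X p) (sublists xs) ≗ genSeries X [ [] ]
genSeries-length-zero X []       s = refl
genSeries-length-zero X (x ∷ xs) s =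
  genSeries-sublists _ x xs s
  ∙ cong₂ ℤ._+_ (q^-cong x (genSeries-none _ (All.universal (λ _ ()) (sublists xs))) s ∙ q^-𝟎 x s)
                (genSeries-length-zero X xs s)
  ∙ ℤP.+-identityˡ _

All-sublists : ∀ {P : ℕ → Set} {xs} → All P xs → All (All P) (sublists xs)
All-sublists []         = [] ∷ []
All-sublists (px ∷ pxs) = ++⁺ (map⁺ (All.map (px ∷_) (All-sublists pxs))) (All-sublists pxs)

sublists-length : ∀ xs → All (λ p → length p ≤ length xs) (sublists xs)
sublists-length []       = z≤n ∷ []
sublists-length (x ∷ xs) =
  ++⁺ (map⁺ (All.map s≤s (sublists-length xs))) (All.map m≤n⇒m≤1+n (sublists-length xs))

partsUpTo-bounds : ∀ t → All (λ x → 0 < x × x ≤ t) (partsUpTo t)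
partsUpTo-bounds zero    = []
partsUpTo-bounds (suc t) =
  (s≤s z≤n , ≤-refl) ∷ All.map (λ (0<x , x≤t) → 0<x , m≤n⇒m≤1+n x≤t) (partsUpTo-bounds t)

sublists-partsUpTo-pos : ∀ t → All (All (0 <_)) (sublists (partsUpTo t))
sublists-partsUpTo-pos t = All-sublists (All.map proj₁ (partsUpTo-bounds t))

sublists-partsUpTo-≤ : ∀ t → All (All (_≤ t)) (sublists (partsUpTo t))
sublists-partsUpTo-≤ t = All-sublists (All.map proj₂ (partsUpTo-bounds t))

sublists-partsUpTo-length : ∀ t → All (λ p → length p ≤ t) (sublists (partsUpTo t))
sublists-partsUpTo-length t =
  subst (λ n → All (λ p → length p ≤ n) (sublists (partsUpTo t)))
        (length-map suc (downFrom t) ∙ length-downFrom t)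
        (sublists-length (partsUpTo t))

-- Rogers–Ramanujan partitions

gaps-cons-below : ∀ u p → All (_≤ u) p → gapsAtLeast2 (2+ u ∷ p) ≡ gapsAtLeast2 p
gaps-cons-below u []       []        = refl
gaps-cons-below u (y ∷ ys) (y≤u ∷ _) =
  cong (_∧ gapsAtLeast2 (y ∷ ys)) (Equivalence.to T-≡ (≤⇒≤ᵇ (s≤s (s≤s y≤u))))

gaps-cons-adjacent : ∀ t p → ¬ T (gapsAtLeast2 (suc t ∷ t ∷ p))
gaps-cons-adjacent t p gaps = n≮n (suc t) (≤ᵇ⇒≤ (2+ t) (suc t) (proj₁ (Equivalence.to T-∧ gaps)))

-- The parts, read from the smallest, are at least 1, 3, 5, …
gaps-head-bound : ∀ x ps → All (0 <_) (x ∷ ps) → T (gapsAtLeast2 (x ∷ ps)) → length ps + length ps < x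
gaps-head-bound x []       (0<x ∷ []) _    = 0<x
gaps-head-bound x (y ∷ ys) (_ ∷ pos)  gaps = begin-strict
  suc (length ys) + suc (length ys) ≡⟨ cong suc (+-suc (length ys) (length ys)) ⟩
  2+ (length ys + length ys)        <⟨ s≤s (s≤s (gaps-head-bound y ys pos (proj₂ gaps′))) ⟩
  2+ y                              ≤⟨ ≤ᵇ⇒≤ (2+ y) x (proj₁ gaps′) ⟩
  x                                 ∎
  where
  open ≤-Reasoning
  gaps′ = Equivalence.to T-∧ gaps

RRSeries : ℕ → ℕ → Series
RRSeries t k = genSeries (λ p → (length p ≡ᵇ k) ∧ gapsAtLeast2 p) (sublists (partsUpTo t))

RRSeries-zero : ∀ t → RRSeries t 0 ≗ δ
RRSeries-zero t zero    = genSeries-length-zero gapsAtLeast2 (partsUpTo t) zero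
RRSeries-zero t (suc s) = genSeries-length-zero gapsAtLeast2 (partsUpTo t) (suc s)

RRSeries-vanish : ∀ t k → t ≤ k + k → RRSeries t (suc k) ≗ 𝟎
RRSeries-vanish t k t≤2k =
  genSeries-none _ (All.zipWith too-long (sublists-partsUpTo-pos t , sublists-partsUpTo-≤ t))
  where
  too-long : ∀ {p} → All (0 <_) p × All (_≤ t) p → ¬ T ((length p ≡ᵇ suc k) ∧ gapsAtLeast2 p)
  too-long {x ∷ ps} (pos , x≤t ∷ _) rr with Equivalence.to T-∧ rr
  ... | len , gaps with ≡ᵇ⇒≡ (length ps) k len
  ... | refl = <⇒≱ (gaps-head-bound x ps pos gaps) (≤-trans x≤t t≤2k)

RRSeries-tail : ∀ t k →
  genSeries (λ p → (length p ≡ᵇ k) ∧ gapsAtLeast2 (suc t ∷ p)) (sublists (partsUpTo t))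
    ≗ RRSeries (t ∸ 1) k
RRSeries-tail zero    k s = refl
RRSeries-tail (suc t) k s =
  genSeries-sublists _ (suc t) (partsUpTo t) s
  ∙ cong₂ ℤ._+_ (q^-cong (suc t) (genSeries-none _ (All.universal adjacent (sublists (partsUpTo t)))) s
                 ∙ q^-𝟎 (suc t) s)
                (genSeries-cong (All.map below (sublists-partsUpTo-≤ t)) s)
  ∙ ℤP.+-identityˡ _
  where
  adjacent : ∀ p → ¬ T ((suc (length p) ≡ᵇ k) ∧ gapsAtLeast2 (2+ t ∷ suc t ∷ p))
  adjacent p = ¬T-∧ʳ (suc (length p) ≡ᵇ k) (gaps-cons-adjacent (suc t) p)
  below : ∀ {p} → All (_≤ t) p →
    (length p ≡ᵇ k) ∧ gapsAtLeast2 (2+ t ∷ p) ≡ (length p ≡ᵇ k) ∧ gapsAtLeast2 p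
  below {p} p≤t = cong ((length p ≡ᵇ k) ∧_) (gaps-cons-below t p p≤t)

RRSeries-suc : ∀ t k → RRSeries (suc t) (suc k) ≗ q^ suc t · RRSeries (t ∸ 1) k ⊕ RRSeries t (suc k)
RRSeries-suc t k s =
  genSeries-sublists _ (suc t) (partsUpTo t) s
  ∙ cong (ℤ._+ RRSeries t (suc k) s) (q^-cong (suc t) (RRSeries-tail t k) s)

-- Subtracting the staircase (2k − 1, …, 3, 1) leaves at most k parts, each at most a.
RRSeries-staircase : ∀ k a → RRSeries (a + k + k ∸ 1) k ≗ q^ k * k · qBinomial k a
RRSeries-staircase zero    a       = RRSeries-zero (a + 0 + 0 ∸ 1)
RRSeries-staircase (suc k) zero    = begin
  RRSeries (k + suc k) (suc k)
    ≡⟨ cong (λ t → RRSeries t (suc k)) (+-suc k k) ⟩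
  RRSeries (suc (k + k)) (suc k)
    ≈⟨ RRSeries-suc (k + k) k ⟩
  q^ suc (k + k) · RRSeries (k + k ∸ 1) k ⊕ RRSeries (k + k) (suc k)
    ≈⟨ ⊕-cong (q^-cong (suc (k + k)) (RRSeries-staircase k zero)) (RRSeries-vanish (k + k) k ≤-refl) ⟩
  q^ suc (k + k) · q^ k * k · qBinomial k 0 ⊕ 𝟎
    ≈⟨ ⊕-identityʳ (q^ suc (k + k) · q^ k * k · qBinomial k 0) ⟩
  q^ suc (k + k) · q^ k * k · qBinomial k 0
    ≈⟨ q^-merge (suc (k + k)) (k * k) (qBinomial k 0) (exponents k) ⟩
  q^ suc k * suc k · qBinomial k 0
    ≈⟨ q^-cong (suc k * suc k) (qBinomial-zeroʳ k) ⟩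
  q^ suc k * suc k · δ ∎
  where
  open ≗-Reasoning
  exponents : ∀ k → suc (k + k) + k * k ≡ suc k * suc k
  exponents = solve-∀
RRSeries-staircase (suc k) (suc a) = begin
  RRSeries (a + suc k + suc k) (suc k)
    ≡⟨ cong (λ t → RRSeries t (suc k)) (bound a k) ⟩
  RRSeries (2+ (a + k + k)) (suc k)
    ≈⟨ RRSeries-suc (suc (a + k + k)) k ⟩
  q^ 2+ (a + k + k) · RRSeries (a + k + k) k ⊕ RRSeries (suc (a + k + k)) (suc k)
    ≈⟨ ⊕-cong (q^-cong (2+ (a + k + k)) (RRSeries-staircase k (suc a))) smaller ⟩
  q^ 2+ (a + k + k) · q^ k * k · B ⊕ q^ suc k * suc k · A
    ≈⟨ ⊕-comm (q^ 2+ (a + k + k) · q^ k * k · B) (q^ suc k * suc k · A) ⟩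
  q^ suc k * suc k · A ⊕ q^ 2+ (a + k + k) · q^ k * k · B
    ≈⟨ ⊕-congˡ (q^ suc k * suc k · A) (q^-regroup (2+ (a + k + k)) (k * k) (suc k * suc k) (suc a) B
                                                     (exponents a k)) ⟩
  q^ suc k * suc k · A ⊕ q^ suc k * suc k · q^ suc a · B
    ≈⟨ q^-⊕ (suc k * suc k) A (q^ suc a · B) ⟨
  q^ suc k * suc k · qBinomial (suc k) (suc a) ∎
  where
  open ≗-Reasoning
  A = qBinomial (suc k) a
  B = qBinomial k (suc a)
  bound : ∀ a k → a + suc k + suc k ≡ 2+ (a + k + k)
  bound = solve-∀
  exponents : ∀ a k → 2+ (a + k + k) + k * k ≡ suc k * suc k + suc a
  exponents = solve-∀
  smaller : RRSeries (suc (a + k + k)) (suc k) ≗ q^ suc k * suc k · A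
  smaller s = cong (λ t → RRSeries t (suc k) s) (sym (cong (_∸ 1) (bound a k)))
              ∙ RRSeries-staircase (suc k) a s

headIs : ℕ → List ℕ → Bool
headIs L []      = false
headIs L (x ∷ _) = x ≡ᵇ L

genSeries-headIs-absent : ∀ (X : List ℕ → Bool) L t → t ≤ L →
  genSeries (λ p → X p ∧ headIs (suc L) p) (sublists (partsUpTo t)) ≗ 𝟎
genSeries-headIs-absent X L t t≤L =
  genSeries-none (λ p → X p ∧ headIs (suc L) p) (All.map too-small (sublists-partsUpTo-≤ t))
  where
  too-small : ∀ {p} → All (_≤ t) p → ¬ T (X p ∧ headIs (suc L) p)
  too-small {[]}     []        = ¬T-∧ʳ (X []) λ ()
  too-small {x ∷ xs} (x≤t ∷ _) = ¬T-∧ʳ (X (x ∷ xs)) λ x≡ →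
    <-irrefl (≡ᵇ⇒≡ x (suc L) x≡) (s≤s (≤-trans x≤t t≤L))

genSeries-headIs-present : ∀ (X : List ℕ → Bool) L t → L < t →
  genSeries (λ p → X p ∧ headIs (suc L) p) (sublists (partsUpTo t))
    ≗ q^ suc L · genSeries (λ p → X (suc L ∷ p)) (sublists (partsUpTo L))
genSeries-headIs-present X L (suc t) (s≤s L≤t) with m≤n⇒m<n∨m≡n L≤t
... | inj₂ refl = begin
  genSeries Y (sublists (partsUpTo (suc L)))
    ≈⟨ genSeries-sublists Y (suc L) (partsUpTo L) ⟩
  q^ suc L · genSeries (λ p → X (suc L ∷ p) ∧ (L ≡ᵇ L)) tails ⊕ genSeries Y tails
    ≈⟨ ⊕-cong (q^-cong (suc L) (genSeries-cong (All.universal right-head tails)))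
              (genSeries-headIs-absent X L L ≤-refl) ⟩
  q^ suc L · genSeries (λ p → X (suc L ∷ p)) tails ⊕ 𝟎
    ≈⟨ ⊕-identityʳ (q^ suc L · genSeries (λ p → X (suc L ∷ p)) tails) ⟩
  q^ suc L · genSeries (λ p → X (suc L ∷ p)) tails ∎
  where
  open ≗-Reasoning
  Y = λ p → X p ∧ headIs (suc L) p
  tails = sublists (partsUpTo L)
  right-head : ∀ p → X (suc L ∷ p) ∧ (L ≡ᵇ L) ≡ X (suc L ∷ p)
  right-head p = cong (X (suc L ∷ p) ∧_) (dec-true (L ≟ L) refl) ∙ ∧-identityʳ _
... | inj₁ L<t = begin
  genSeries Y (sublists (partsUpTo (suc t)))
    ≈⟨ genSeries-sublists Y (suc t) (partsUpTo t) ⟩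
  q^ suc t · genSeries (λ p → X (suc t ∷ p) ∧ (t ≡ᵇ L)) tails ⊕ genSeries Y tails
    ≈⟨ ⊕-cong (λ s → q^-cong (suc t) (genSeries-none _ (All.universal wrong-head tails)) s
                     ∙ q^-𝟎 (suc t) s)
              (genSeries-headIs-present X L t L<t) ⟩
  𝟎 ⊕ q^ suc L · genSeries (λ p → X (suc L ∷ p)) (sublists (partsUpTo L))
    ≈⟨ ⊕-identityˡ (q^ suc L · genSeries (λ p → X (suc L ∷ p)) (sublists (partsUpTo L))) ⟩
  q^ suc L · genSeries (λ p → X (suc L ∷ p)) (sublists (partsUpTo L)) ∎
  where
  open ≗-Reasoning
  Y = λ p → X p ∧ headIs (suc L) p
  tails = sublists (partsUpTo t)
  wrong-head : ∀ p → ¬ T (X (suc t ∷ p) ∧ (t ≡ᵇ L))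
  wrong-head p = ¬T-∧ʳ (X (suc t ∷ p)) (λ t≡ → <-irrefl (sym (≡ᵇ⇒≡ t L t≡)) L<t)

-- Coefficients of degree s ≤ t do not see parts larger than t.
genSeries-headIs : ∀ (X : List ℕ → Bool) L t s → s ≤ t →
  genSeries (λ p → X p ∧ headIs (suc L) p) (sublists (partsUpTo t)) s
    ≡ (q^ suc L · genSeries (λ p → X (suc L ∷ p)) (sublists (partsUpTo L))) s
genSeries-headIs X L t s s≤t with <-≤-connex L t
... | inj₁ L<t = genSeries-headIs-present X L t L<t s
... | inj₂ t≤L =
  genSeries-headIs-absent X L t t≤L s ∙ sym (q^-< (suc L) _ (s≤s (≤-trans s≤t t≤L)))

-- The rank

==ℤ-does : ∀ i j → (i ==ℤ j) ≡ does (i ℤ.≟ j)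
==ℤ-does (+ a)    (+ b)    = refl
==ℤ-does (+ a)    -[1+ b ] = refl
==ℤ-does -[1+ a ] (+ b)    = refl
==ℤ-does -[1+ a ] -[1+ b ] = refl

==ℤ⇒≡ : ∀ i j → T (i ==ℤ j) → i ≡ j
==ℤ⇒≡ (+ a)    (+ b)    a≡b = cong +_ (≡ᵇ⇒≡ a b a≡b)
==ℤ⇒≡ -[1+ a ] -[1+ b ] a≡b = cong -[1+_] (≡ᵇ⇒≡ a b a≡b)

i-j+j≡i : ∀ i j → i ℤ.- j ℤ.+ j ≡ i
i-j+j≡i = ℤ-Solver.solve-∀

i+j-j≡i : ∀ i j → i ℤ.+ j ℤ.- j ≡ i
i+j-j≡i = ℤ-Solver.solve-∀

i+1-[1+j]≡i-j : ∀ i j → i ℤ.+ 1ℤ ℤ.- (1ℤ ℤ.+ j) ≡ i ℤ.- j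
i+1-[1+j]≡i-j = ℤ-Solver.solve-∀

rank-head : ∀ x ps k a → length ps ≡ k →
  (rank (x ∷ ps) ==ℤ (+ (a + k))) ≡ (x ≡ᵇ suc (a + k + k))
rank-head x ps k a refl =
  ==ℤ-does (rank (x ∷ ps)) (+ (a + k))
  ∙ does-⇔ (mk⇔ to from) (rank (x ∷ ps) ℤ.≟ + (a + k)) (x ≟ suc (a + k + k))
  where
  head≡ : a + k + suc k ≡ suc (a + k + k)
  head≡ = +-suc (a + k) k
  to : + x ℤ.- + suc k ≡ + (a + k) → x ≡ suc (a + k + k)
  to e = ℤP.+-injective (sym (i-j+j≡i (+ x) (+ suc k)) ∙ cong (ℤ._+ + suc k) e) ∙ head≡
  from : x ≡ suc (a + k + k) → + x ℤ.- + suc k ≡ + (a + k)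
  from refl = cong (λ y → + y ℤ.- + suc k) (sym head≡) ∙ i+j-j≡i (+ (a + k)) (+ suc k)

rank-as-head : ∀ k a p →
  (length p ≡ᵇ suc k) ∧ (gapsAtLeast2 p ∧ (rank p ==ℤ (+ (a + k))))
    ≡ ((length p ≡ᵇ suc k) ∧ gapsAtLeast2 p) ∧ headIs (suc (a + k + k)) p
rank-as-head k a []       = refl
rank-as-head k a (x ∷ ps) with length ps ≡ᵇ k in len
... | false = refl
... | true  =
  cong (gapsAtLeast2 (x ∷ ps) ∧_) (rank-head x ps k a (≡ᵇ⇒≡ _ _ (Equivalence.from T-≡ len)))

gaps-rank-bound : ∀ x ps → All (0 <_) (x ∷ ps) → T (gapsAtLeast2 (x ∷ ps)) →
  + length ps ℤ.≤ rank (x ∷ ps)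
gaps-rank-bound x ps pos gaps = subst (+ ℓ ℤ.≤_) (sym rank≡) (+≤+ (m+n≤o⇒m≤o∸n ℓ ℓ+1+ℓ≤x))
  where
  ℓ = length ps
  ℓ+1+ℓ≤x : ℓ + suc ℓ ≤ x
  ℓ+1+ℓ≤x = subst (_≤ x) (sym (+-suc ℓ ℓ)) (gaps-head-bound x ps pos gaps)
  rank≡ : rank (x ∷ ps) ≡ + (x ∸ suc ℓ)
  rank≡ = ℤP.m-n≡m⊖n x (suc ℓ) ∙ ℤP.⊖-≥ (≤-trans (m≤n+m (suc ℓ) ℓ) ℓ+1+ℓ≤x)

RRRankSeries : ℕ → ℕ → ℤ → Series
RRRankSeries t n m =
  genSeries (λ p → (length p ≡ᵇ n) ∧ (gapsAtLeast2 p ∧ (rank p ==ℤ m))) (sublists (partsUpTo t))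

RRRankSeries-nonneg : ∀ k a N →
  RRRankSeries N (suc k) (+ (a + k)) N ≡ (q^ suc k * suc k · q^ a · qBinomial k a) N
RRRankSeries-nonneg k a N = begin
  RRRankSeries N (suc k) (+ (a + k)) N
    ≡⟨ genSeries-cong (All.universal (rank-as-head k a) (sublists (partsUpTo N))) N ⟩
  genSeries (λ p → RR p ∧ headIs (suc L) p) (sublists (partsUpTo N)) N
    ≡⟨ genSeries-headIs RR L N N ≤-refl ⟩
  (q^ suc L · genSeries (λ p → (length p ≡ᵇ k) ∧ gapsAtLeast2 (suc L ∷ p)) tails) N
    ≡⟨ q^-cong (suc L) (λ s → RRSeries-tail L k s ∙ RRSeries-staircase k a s) N ⟩
  (q^ suc L · q^ k * k · qBinomial k a) N
    ≡⟨ q^-regroup (suc L) (k * k) (suc k * suc k) a (qBinomial k a) (exponents a k) N ⟩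
  (q^ suc k * suc k · q^ a · qBinomial k a) N ∎
  where
  open ≡-Reasoning
  L = a + k + k
  tails = sublists (partsUpTo L)
  RR = λ p → (length p ≡ᵇ suc k) ∧ gapsAtLeast2 p
  exponents : ∀ a k → suc (a + k + k) + k * k ≡ suc k * suc k + a
  exponents = solve-∀

RRRankSeries-neg : ∀ t k m j → m ℤ.- + k ≡ -[1+ j ] → RRRankSeries t (suc k) m ≗ 𝟎
RRRankSeries-neg t k m j m-k<0 = genSeries-none _ (All.map impossible (sublists-partsUpTo-pos t))
  where
  impossible : ∀ {p} → All (0 <_) p →
    ¬ T ((length p ≡ᵇ suc k) ∧ (gapsAtLeast2 p ∧ (rank p ==ℤ m)))
  impossible {x ∷ ps} pos rr with Equivalence.to T-∧ rr
  ... | len , gaps∧rank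
    with Equivalence.to (T-∧ {gapsAtLeast2 (x ∷ ps)}) gaps∧rank | ≡ᵇ⇒≡ (length ps) k len
  ... | gaps , rank≡m | refl
    with subst (0ℤ ℤ.≤_) m-k<0 (ℤP.i≤j⇒0≤j-i
           (subst (+ k ℤ.≤_) (==ℤ⇒≡ _ m rank≡m) (gaps-rank-bound x ps pos gaps)))
  ... | ()

termCoeff-nonneg : ∀ n m N a → m ℤ.+ 1ℤ ℤ.- + n ≡ + a →
  termCoeff n m N ≡ (q^ n * n · invPoch n a) N
termCoeff-nonneg n m N a eq = unfold eq ∙ sym (q^-≤ᵇ (n * n) (invPoch n a) N)
  where
  unfold : m ℤ.+ 1ℤ ℤ.- + n ≡ + a →
    termCoeff n m N ≡ (if n * n ≤ᵇ N then invPoch n a (N ∸ n * n) else 0ℤ)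
  unfold eq with m ℤ.+ 1ℤ ℤ.- + n | n * n ≤ᵇ N
  unfold refl | .(+ a) | true  = refl
  unfold refl | .(+ a) | false = refl

termCoeff-neg : ∀ n m N j → m ℤ.+ 1ℤ ℤ.- + n ≡ -[1+ j ] → termCoeff n m N ≡ 0ℤ
termCoeff-neg n m N j eq with m ℤ.+ 1ℤ ℤ.- + n | n * n ≤ᵇ N
termCoeff-neg n m N j refl | .(-[1+ j ]) | _ = refl

RRRankSeries-zero : ∀ m N → RRRankSeries N 0 m N ≡ termCoeff 0 m N
RRRankSeries-zero m N = genSeries-length-zero _ (partsUpTo N) N ∙ empty m N
  where
  m+1≡ : ∀ x → + x ℤ.+ 1ℤ ℤ.- + 0 ≡ + suc x
  m+1≡ x = cong +_ (+-identityʳ (x + 1) ∙ +-comm x 1)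
  empty : ∀ m N → genSeries (λ p → gapsAtLeast2 p ∧ (rank p ==ℤ m)) [ [] ] N ≡ termCoeff 0 m N
  empty (+ x)        zero    = sym (termCoeff-nonneg 0 (+ x) 0 (suc x) (m+1≡ x))
  empty (+ x)        (suc N) = sym (termCoeff-nonneg 0 (+ x) (suc N) (suc x) (m+1≡ x))
  empty -[1+ zero ]  zero    = sym (termCoeff-nonneg 0 -1ℤ 0 0 refl)
  empty -[1+ zero ]  (suc N) = sym (termCoeff-nonneg 0 -1ℤ (suc N) 0 refl)
  empty -[1+ suc y ] zero    = sym (termCoeff-neg 0 -[1+ suc y ] 0 y refl)
  empty -[1+ suc y ] (suc N) = sym (termCoeff-neg 0 -[1+ suc y ] (suc N) y refl)

RRRankSeries-suc : ∀ k m N → RRRankSeries N (suc k) m N ≡ termCoeff (suc k) m N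
RRRankSeries-suc k m N = by-sign (m ℤ.+ 1ℤ ℤ.- + suc k) refl
  where
  open ≡-Reasoning
  by-sign : ∀ i → m ℤ.+ 1ℤ ℤ.- + suc k ≡ i → RRRankSeries N (suc k) m N ≡ termCoeff (suc k) m N
  by-sign -[1+ j ] eq =
    RRRankSeries-neg N k m j (sym (i+1-[1+j]≡i-j m (+ k)) ∙ eq) N ∙ sym (termCoeff-neg (suc k) m N j eq)
  by-sign (+ a)    eq = begin
    RRRankSeries N (suc k) m N                  ≡⟨ cong (λ m → RRRankSeries N (suc k) m N) m≡a+k ⟩
    RRRankSeries N (suc k) (+ (a + k)) N        ≡⟨ RRRankSeries-nonneg k a N ⟩
    (q^ suc k * suc k · q^ a · qBinomial k a) N ≡⟨ q^-cong (suc k * suc k) (invPoch-suc k a) N ⟨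
    (q^ suc k * suc k · invPoch (suc k) a) N    ≡⟨ termCoeff-nonneg (suc k) m N a eq ⟨
    termCoeff (suc k) m N                       ∎
    where
    m≡a+k : m ≡ + (a + k)
    m≡a+k = sym (i-j+j≡i m (+ k)) ∙ cong (ℤ._+ + k) (sym (i+1-[1+j]≡i-j m (+ k)) ∙ eq)

theorem1p1 : (m : ℤ) (n : ℕ) → + R m n ≡ rhsCoeff m n
theorem1p1 m N = begin
  + R m N
    ≡⟨ count-filterᵇ _ _ partitions ⟩
  count (λ p → ((sum p ≡ᵇ N) ∧ gapsAtLeast2 p) ∧ (rank p ==ℤ m)) partitions
    ≡⟨ count-cong (All.universal (λ p → ∧-assoc (sum p ≡ᵇ N) _ _) partitions) ⟩
  genSeries (λ p → gapsAtLeast2 p ∧ (rank p ==ℤ m)) partitions N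
    ≡⟨ genSeries-by-length N _ partitions (sublists-partsUpTo-length N) N ⟩
  sumTo N (λ n → RRRankSeries N n m N)
    ≡⟨ sumTo-cong N (λ n _ → by-length n) ⟩
  rhsCoeff m N ∎
  where
  open ≡-Reasoning
  partitions = sublists (partsUpTo N)
  by-length : ∀ n → RRRankSeries N n m N ≡ termCoeff n m N
  by-length zero    = RRRankSeries-zero m N
  by-length (suc k) = RRRankSeries-suc k m N
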